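{- There exists a unique $\mathbf{Z}$-linear map $\delta:\mathbf{Z}^{(\mathcal{B})}\to\mathbf{Z}^{(\mathcal{A})}$, graded of degree $0$ for the weight (i.e. $\delta(\mathbf{Z}^{\mathcal{B}_k})\subset\mathbf{Z}^{\mathcal{A}_k}$ for all $k\geqslant 0$), such that $\delta([\varnothing])=\varnothing$ and $\mu\circ\delta^*=\delta\circ\alpha$, where $\delta^*:\mathbf{Z}^{(\mathcal{B}^*)}\to\mathbf{Z}^{(\mathcal{A}^*)}$ is the map induced by $\delta$. Equivalently, $\delta([\mathbf{a}])^{\rm init}=\delta([\mathbf{a}^{\rm init}])+\delta([\mathbf{a}^{\rm mid}])+\delta([\mathbf{a}^{\rm fin}])$ for every non-empty admissible composition $\mathbf{a}$.
   Context: A composition is a finite sequence $\mathbf{a}=(a_1,\ldots,a_r)$ of positive integers ($r\geqslant 0$); $r$ is its depth and $|\mathbf{a}|=a_1+\cdots+a_r$ its weight. It is admissible if $r=0$ or $a_1\geqslant 2$. $\mathcal{A}$ is the set of admissible compositions, $\mathcal{A}^*=\mathcal{A}\setminus\{\varnothing\}$, $\mathcal{A}_k$ those of weight $k$. The binary word of $\mathbf{a}$ is $\mathbf{w}(\mathbf{a})=0^{a_1-1}1\,0^{a_2-1}1\cdots0^{a_r-1}1$ (where $0^u$ denotes $u$ zeros); $\mathbf{w}$ is a bijection from compositions onto words in $\{0,1\}$ not ending in $0$. The dual of a word $\varepsilon_1\cdots\varepsilon_k$ is $\overline{\varepsilon_k}\cdots\overline{\varepsilon_1}$ with $\overline{0}=1,\overline{1}=0$;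 for $\mathbf{a}$ admissible, the dual composition $\overline{\mathbf{a}}$ is the admissible composition whose word is dual to $\mathbf{w}(\mathbf{a})$. $\mathcal{B}$ is the quotient of $\mathcal{A}$ by $\mathbf{a}\sim\overline{\mathbf{a}}$, $[\mathbf{a}]$ the class of $\mathbf{a}$, $\mathcal{B}_k$ the classes of weight $k$, $\mathcal{B}^*=\mathcal{B}\setminus\{[\varnothing]\}$. $\mathbf{Z}^{(X)}$ is the free $\mathbf{Z}$-module on $X$. For a composition $\mathbf{a}=(a_1,\ldots,a_r)$, $\mathbf{a}^{\rm init}=(a_1,\ldots,a_{r-1})$ if $r\geqslant1$ and $\varnothing^{\rm init}=\varnothing$. For admissible $\mathbf{a}$, $\mathbf{a}^{\rm fin}$ is the dual of $(\overline{\mathbf{a}})^{\rm init}$ and $\mathbf{a}^{\rm mid}=(\mathbf{a}^{\rm fin})^{\rm init}$; these maps are extended $\mathbf{Z}$-linearly. $\mu:\mathbf{Z}^{(\mathcal{A}^*)}\to\mathbf{Z}^{(\mathcal{A})}$ is the $\mathbf{Z}$-linear map $\mathbf{a}\mapsto\mathbf{a}^{\rm init}$. $\alpha:\mathbf{Z}^{(\mathcal{B}^*)}\to\mathbf{Z}^{(\mathcal{B})}$ is the $\mathbf{Z}$-linear map sending $[\mathbf{a}]$ to $[\mathbf{a}^{\rm init}]+[\mathbf{a}^{\rm mid}]+[\mathbf{a}^{\rm fin}]$ (this is well defined, i.e. independent of the representative). -}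

module Defs where

open import Data.Nat using (ℕ; zero; suc; _≤_; _∸_)
open import Data.Bool using (Bool; true; false; not; if_then_else_)
open import Data.List using (List; []; _∷_; _++_; map; reverse; replicate; concatMap)
open import Data.Nat.ListAction using (sum)
open import Data.List.Relation.Unary.All using (All)
open import Data.List.Properties using (≡-dec)
open import Data.Integer using (ℤ; 0ℤ; 1ℤ; _+_)
open import Data.Product using (_×_; _,_)
open import Relation.Nullary using (¬_; does)
open import Relation.Binary.PropositionalEquality using (_≡_)
import Data.Nat as N

-- Compositions are lists of natural numbers (positivity is imposed by 'Admissible').
Composition : Set
Composition = List ℕ

weight : Composition → ℕ
weight = sum

data Admissible : Composition → Set where
  adm-nil  : Admissible []
  adm-cons : ∀ {x xs} → 2 ≤ x → All (1 ≤_) xs → Admissible (x ∷ xs)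

-- Binary words: false = 0, true = 1.
word : Composition → List Bool
word = concatMap (λ a → replicate (a ∸ 1) false ++ (true ∷ []))

-- Inverse of 'word' on words not ending in 0.
fromWord′ : ℕ → List Bool → Composition
fromWord′ n []           = []
fromWord′ n (false ∷ w)  = fromWord′ (suc n) w
fromWord′ n (true ∷ w)   = suc n ∷ fromWord′ 0 w

fromWord : List Bool → Composition
fromWord = fromWord′ 0

dualWord : List Bool → List Bool
dualWord w = reverse (map not w)

dual : Composition → Composition
dual a = fromWord (dualWord (word a))

init : Composition → Composition
init []           = []
init (x ∷ [])     = []
init (x ∷ y ∷ xs) = x ∷ init (y ∷ xs)

fin : Composition → Composition
fin a = dual (init (dual a))

mid : Composition → Composition
mid a = init (fin a)

FreeZ : Set
FreeZ = List (ℤ × Composition)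

coeff : FreeZ → Composition → ℤ
coeff []            c = 0ℤ
coeff ((z , a) ∷ v) c = (if does (≡-dec N._≟_ a c) then z else 0ℤ) + coeff v c

_≈_ : FreeZ → FreeZ → Set
v ≈ w = ∀ c → coeff v c ≡ coeff w c

infix 4 _≈_

⟦_⟧ : Composition → FreeZ
⟦ a ⟧ = (1ℤ , a) ∷ []

_⊕_ : FreeZ → FreeZ → FreeZ
_⊕_ = _++_

infixl 6 _⊕_

InA : ℕ → FreeZ → Set
InA k v = ∀ c → ¬ (coeff v c ≡ 0ℤ) → Admissible c × weight c ≡ k

μ : FreeZ → FreeZ
μ = map (λ { (z , a) → (z , init a) })

-- A Z-linear map δ : Z^(B) → Z^(A) is given by its values on the basis B,
-- i.e. by a function d on admissible compositions with d a ≈ d (dual a).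
-- The conditions of Theorem 10 on such a d:
IsDelta : (Composition → FreeZ) → Set
IsDelta d =
    (∀ a → Admissible a → d a ≈ d (dual a))                 -- well defined on classes [a]
  × (∀ a → Admissible a → InA (weight a) (d a))
  × (d [] ≈ ⟦ [] ⟧)
  × (∀ x xs → Admissible (x ∷ xs) →
       μ (d (x ∷ xs)) ≈ d (init (x ∷ xs)) ⊕ d (mid (x ∷ xs)) ⊕ d (fin (x ∷ xs)))

-- On a composition of weight k, the maps init, mid and fin produce admissible compositions of smaller
-- weight, and μ is injective on combinations of compositions of weight k (such a composition is determined
-- by its init), with right inverse lift k appending the missing last part. So the conditions force
-- δ(a) = lift k (δ(a^init) + δ(a^mid) + δ(a^fin)) by recursion on the weight, and this recursion defines δ.
-- It is well defined on classes because duality permutes the three parts: the dual of a has init, mid, fin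
-- the duals of a^fin, a^mid, a^init; for mid this holds because taking fin commutes with taking init.

module Submission where

open import Defs
open import Data.Bool using (true; false; not; if_then_else_)
open import Data.Bool.Properties using (not-involutive)
open import Data.Empty using (⊥-elim)
open import Data.Integer using (ℤ; 0ℤ; -_; _-_) renaming (_+_ to _+ℤ_)
import Data.Integer.Properties as ℤ
open import Algebra.Properties.CommutativeSemigroup ℤ.+-commutativeSemigroup using (xy∙z≈zy∙x; x∙yz≈y∙xz)
open import Data.List using ([]; _∷_; _++_; _∷ʳ_; map; reverse; replicate; length; filter; initLast; _∷ʳ′_)
open import Data.List.Properties
  using (≡-dec; ++-assoc; ++-identityʳ; length-++; length-replicate; length-reverse; length-map; map-++;
         reverse-++; reverse-map; reverse-involutive; unfold-reverse; map-id; map-∘; length-filter; filter-reject)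
open import Data.List.Relation.Unary.All using (All; []; _∷_)
import Data.List.Relation.Unary.All as All
open import Data.List.Relation.Unary.All.Properties using (++⁺; map⁺)
import Data.Nat as ℕ
open import Data.Nat using (ℕ; zero; suc; _+_; _∸_; _≤_; _<_; z≤n; s≤s)
open import Data.Nat.ListAction.Properties using (sum-++)
open import Data.Nat.Properties
  using (≤-refl; ≤-trans; <-≤-trans; ≤-<-trans; n<1+n; m≤n⇒m≤1+n; +-suc; +-identityʳ; +-monoʳ-≤; +-monoʳ-<;
         m≤m+n; m<n⇒0<n∸m; m+[n∸m]≡n; m+n∸m≡n; 0≢1+n; <⇒≤)
open import Data.Product using (Σ; ∃; _×_; _,_; proj₂; map₁; map₂)
open import Function using (_∘_; id)
open import Relation.Binary.Bundles using (Setoid)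
import Relation.Binary.Reasoning.Setoid as SetoidReasoning
open import Relation.Binary.PropositionalEquality
open import Relation.Nullary using (Dec; does; yes; no; ¬?)

Positive : Composition → Set
Positive = All (1 ≤_)

admissible⇒positive : ∀ {a} → Admissible a → Positive a
admissible⇒positive adm-nil              = []
admissible⇒positive (adm-cons (s≤s _) ps) = s≤s z≤n ∷ ps

weight≥2 : ∀ {x xs} → Admissible (x ∷ xs) → 2 ≤ weight (x ∷ xs)
weight≥2 {x} {xs} (adm-cons 2≤x _) = ≤-trans 2≤x (m≤m+n x (weight xs))

weight-∷ʳ : ∀ xs x → weight (xs ∷ʳ x) ≡ weight xs + x
weight-∷ʳ xs x = trans (sum-++ xs (x ∷ [])) (cong (weight xs +_) (+-identityʳ x))

init-∷ʳ : ∀ xs (x : ℕ) → init (xs ∷ʳ x) ≡ xs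
init-∷ʳ []           x = refl
init-∷ʳ (y ∷ [])     x = refl
init-∷ʳ (y ∷ z ∷ xs) x = cong (y ∷_) (init-∷ʳ (z ∷ xs) x)

All-init : ∀ {P : ℕ → Set} {xs} → All P xs → All P (init xs)
All-init []                 = []
All-init (px ∷ [])          = []
All-init (px ∷ py ∷ pys)    = px ∷ All-init (py ∷ pys)

init-admissible : ∀ {a} → Admissible a → Admissible (init a)
init-admissible adm-nil                       = adm-nil
init-admissible (adm-cons {xs = []} _ _)      = adm-nil
init-admissible (adm-cons {xs = _ ∷ _} p ps)  = adm-cons p (All-init ps)

weight-init-≤ : ∀ a → weight (init a) ≤ weight a
weight-init-≤ []           = z≤n
weight-init-≤ (x ∷ [])     = z≤n
weight-init-≤ (x ∷ y ∷ ys) = +-monoʳ-≤ x (weight-init-≤ (y ∷ ys))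

weight-init-< : ∀ {x xs} → Positive (x ∷ xs) → weight (init (x ∷ xs)) < weight (x ∷ xs)
weight-init-< {x} {[]}     (1≤x ∷ []) = ≤-trans 1≤x (m≤m+n x 0)
weight-init-< {x} {_ ∷ _}  (_ ∷ ps)   = +-monoʳ-< x (weight-init-< ps)

-- Binary words and duality

replicate-∷ʳ : ∀ {A : Set} n (x : A) → replicate n x ∷ʳ x ≡ x ∷ replicate n x
replicate-∷ʳ zero    x = refl
replicate-∷ʳ (suc n) x = cong (x ∷_) (replicate-∷ʳ n x)

replicate-suc-++ : ∀ {A : Set} n (x : A) w → replicate (suc n) x ++ w ≡ replicate n x ++ x ∷ w
replicate-suc-++ n x w = sym (trans (sym (++-assoc (replicate n x) (x ∷ []) w)) (cong (_++ w) (replicate-∷ʳ n x)))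

word-∷ : ∀ x xs → word (x ∷ xs) ≡ replicate (x ∸ 1) false ++ true ∷ word xs
word-∷ x xs = ++-assoc (replicate (x ∸ 1) false) (true ∷ []) (word xs)

word-∷-++ : ∀ x xs s → word (x ∷ xs) ++ s ≡ replicate (x ∸ 1) false ++ true ∷ (word xs ++ s)
word-∷-++ x xs s = trans (cong (_++ s) (word-∷ x xs)) (++-assoc (replicate (x ∸ 1) false) (true ∷ word xs) s)

word-∷ʳ : ∀ x xs → ∃ λ u → word (x ∷ xs) ≡ u ∷ʳ true
word-∷ʳ x []       = replicate (x ∸ 1) false , ++-identityʳ _
word-∷ʳ x (y ∷ ys) with word-∷ʳ y ys
... | u , eq = replicate (x ∸ 1) false ++ true ∷ u ,
               trans (word-∷ x (y ∷ ys)) (trans (cong (λ w → replicate (x ∸ 1) false ++ true ∷ w) eq)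
                                                (sym (++-assoc (replicate (x ∸ 1) false) (true ∷ u) (true ∷ []))))

length-word : ∀ {a} → Positive a → length (word a) ≡ weight a
length-word [] = refl
length-word {suc x ∷ xs} (_ ∷ ps) = begin
  length (word (suc x ∷ xs))                     ≡⟨ cong length (word-∷ (suc x) xs) ⟩
  length (replicate x false ++ true ∷ word xs)    ≡⟨ length-++ (replicate x false) ⟩
  length (replicate x false) + suc (length (word xs)) ≡⟨ cong₂ (λ m n → m + suc n) (length-replicate x) (length-word ps) ⟩
  x + suc (weight xs)                            ≡⟨ +-suc x (weight xs) ⟩
  suc x + weight xs                              ∎
  where open ≡-Reasoning

fromWord′-replicate : ∀ n k w → fromWord′ n (replicate k false ++ w) ≡ fromWord′ (k + n) w
fromWord′-replicate n zero    w = refl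
fromWord′-replicate n (suc k) w = trans (fromWord′-replicate (suc n) k w) (cong (λ m → fromWord′ m w) (+-suc k n))

fromWord-word-++ : ∀ {b} → Positive b → ∀ s → fromWord (word b ++ s) ≡ b ++ fromWord s
fromWord-word-++ [] s = refl
fromWord-word-++ {suc x ∷ xs} (_ ∷ ps) s = begin
  fromWord (word (suc x ∷ xs) ++ s)                   ≡⟨ cong fromWord (word-∷-++ (suc x) xs s) ⟩
  fromWord′ 0 (replicate x false ++ true ∷ (word xs ++ s)) ≡⟨ fromWord′-replicate 0 x _ ⟩
  suc (x + 0) ∷ fromWord (word xs ++ s)               ≡⟨ cong₂ (λ m t → suc m ∷ t) (+-identityʳ x) (fromWord-word-++ ps s) ⟩
  suc x ∷ xs ++ fromWord s                            ∎
  where open ≡-Reasoning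

fromWord-word : ∀ {a} → Positive a → fromWord (word a) ≡ a
fromWord-word {a} pa = trans (cong fromWord (sym (++-identityʳ (word a))))
                             (trans (fromWord-word-++ pa []) (++-identityʳ a))

word-fromWord′ : ∀ n u → word (fromWord′ n (u ∷ʳ true)) ≡ replicate n false ++ u ∷ʳ true
word-fromWord′ n []          = ++-identityʳ _
word-fromWord′ n (false ∷ u) = trans (word-fromWord′ (suc n) u) (replicate-suc-++ n false (u ∷ʳ true))
word-fromWord′ n (true ∷ u)  = trans (word-∷ (suc n) (fromWord′ 0 (u ∷ʳ true))) (cong (λ w → replicate n false ++ true ∷ w) (word-fromWord′ 0 u))

positive-fromWord′ : ∀ n w → Positive (fromWord′ n w)
positive-fromWord′ n []          = []
positive-fromWord′ n (false ∷ w) = positive-fromWord′ (suc n) w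
positive-fromWord′ n (true ∷ w)  = s≤s z≤n ∷ positive-fromWord′ 0 w

admissible-fromWord′ : ∀ n u → Admissible (fromWord′ (suc n) (u ∷ʳ true))
admissible-fromWord′ n []          = adm-cons (s≤s (s≤s z≤n)) []
admissible-fromWord′ n (false ∷ u) = admissible-fromWord′ (suc n) u
admissible-fromWord′ n (true ∷ u)  = adm-cons (s≤s (s≤s z≤n)) (positive-fromWord′ 0 (u ∷ʳ true))

dualWord-++ : ∀ u v → dualWord (u ++ v) ≡ dualWord v ++ dualWord u
dualWord-++ u v = trans (cong reverse (map-++ not u v)) (reverse-++ (map not u) (map not v))

dualWord-involutive : ∀ w → dualWord (dualWord w) ≡ w
dualWord-involutive w = begin
  reverse (map not (reverse (map not w))) ≡⟨ cong reverse (reverse-map not (map not w)) ⟩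
  reverse (reverse (map not (map not w))) ≡⟨ reverse-involutive _ ⟩
  map not (map not w)                     ≡⟨ map-not-not w ⟩
  w                                       ∎
  where
  open ≡-Reasoning
  map-not-not : ∀ w → map not (map not w) ≡ w
  map-not-not []      = refl
  map-not-not (b ∷ w) = cong₂ _∷_ (not-involutive b) (map-not-not w)

length-dualWord : ∀ w → length (dualWord w) ≡ length w
length-dualWord w = trans (length-reverse (map not w)) (length-map not w)

dualWord-replicate : ∀ m → dualWord (replicate m true) ≡ replicate m false
dualWord-replicate zero    = refl
dualWord-replicate (suc m) = begin
  dualWord (true ∷ replicate m true)    ≡⟨ unfold-reverse false (map not (replicate m true)) ⟩
  dualWord (replicate m true) ∷ʳ false  ≡⟨ cong (_∷ʳ false) (dualWord-replicate m) ⟩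
  replicate m false ∷ʳ false            ≡⟨ replicate-∷ʳ m false ⟩
  replicate (suc m) false               ∎
  where open ≡-Reasoning

dualWord-frame : ∀ v → dualWord (false ∷ v ∷ʳ true) ≡ false ∷ dualWord v ∷ʳ true
dualWord-frame v = trans (dualWord-++ (false ∷ v) (true ∷ [])) (cong (false ∷_) (dualWord-++ (false ∷ []) v))

dualWord-word-framed : ∀ {x xs} → Admissible (x ∷ xs) → ∃ λ v → dualWord (word (x ∷ xs)) ≡ false ∷ v ∷ʳ true
dualWord-word-framed (adm-cons {suc (suc x)} {xs} (s≤s (s≤s _)) _) with word-∷ʳ (suc x) xs
... | u , eq = dualWord u , trans (cong (dualWord ∘ (false ∷_)) eq) (dualWord-frame u)

word-dual : ∀ {a} → Admissible a → word (dual a) ≡ dualWord (word a)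
word-dual adm-nil = refl
word-dual {a} ad@(adm-cons _ _) with dualWord-word-framed ad
... | v , eq = trans (cong (word ∘ fromWord) eq) (trans (word-fromWord′ 0 (false ∷ v)) (sym eq))

dual-admissible : ∀ {a} → Admissible a → Admissible (dual a)
dual-admissible adm-nil = adm-nil
dual-admissible ad@(adm-cons _ _) with dualWord-word-framed ad
... | v , eq = subst Admissible (sym (cong fromWord eq)) (admissible-fromWord′ 0 v)

dual-involutive : ∀ {a} → Admissible a → dual (dual a) ≡ a
dual-involutive {a} ad = begin
  fromWord (dualWord (word (dual a)))       ≡⟨ cong (fromWord ∘ dualWord) (word-dual ad) ⟩
  fromWord (dualWord (dualWord (word a)))   ≡⟨ cong fromWord (dualWord-involutive (word a)) ⟩
  fromWord (word a)                         ≡⟨ fromWord-word (admissible⇒positive ad) ⟩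
  a                                         ∎
  where open ≡-Reasoning

weight-dual : ∀ {a} → Admissible a → weight (dual a) ≡ weight a
weight-dual {a} ad = begin
  weight (dual a)               ≡⟨ sym (length-word (admissible⇒positive (dual-admissible ad))) ⟩
  length (word (dual a))        ≡⟨ cong length (word-dual ad) ⟩
  length (dualWord (word a))    ≡⟨ length-dualWord (word a) ⟩
  length (word a)               ≡⟨ length-word (admissible⇒positive ad) ⟩
  weight a                      ∎
  where open ≡-Reasoning

dropLeadingOnes : Composition → Composition
dropLeadingOnes (1 ∷ xs) = dropLeadingOnes xs
dropLeadingOnes xs       = xs

-- In words, fin deletes the prefix 0 1^m of the word 0 1^m q, where q is empty or starts with 0.
fin′ : Composition → Composition
fin′ (suc (suc (suc x)) ∷ xs) = suc (suc x) ∷ xs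
fin′ (2 ∷ xs)                 = dropLeadingOnes xs
fin′ _                        = []

word-dropLeadingOnes : ∀ xs → ∃ λ m → word xs ≡ replicate m true ++ word (dropLeadingOnes xs)
word-dropLeadingOnes []                 = 0 , refl
word-dropLeadingOnes (zero ∷ xs)        = 0 , refl
word-dropLeadingOnes (suc zero ∷ xs)    with word-dropLeadingOnes xs
... | m , eq = suc m , cong (true ∷_) eq
word-dropLeadingOnes (suc (suc x) ∷ xs) = 0 , refl

word-fin′ : ∀ {x xs} → Admissible (x ∷ xs) → ∃ λ m → word (x ∷ xs) ≡ false ∷ replicate m true ++ word (fin′ (x ∷ xs))
word-fin′ (adm-cons {suc zero} (s≤s ()) _)
word-fin′ (adm-cons {suc (suc zero)} {xs} _ _) with word-dropLeadingOnes xs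
... | m , eq = suc m , cong (λ w → false ∷ true ∷ w) eq
word-fin′ (adm-cons {suc (suc (suc x))} _ _) = 0 , refl

dropLeadingOnes-admissible : ∀ {xs} → Positive xs → Admissible (dropLeadingOnes xs)
dropLeadingOnes-admissible []                            = adm-nil
dropLeadingOnes-admissible {suc zero ∷ _}    (_ ∷ ps)    = dropLeadingOnes-admissible ps
dropLeadingOnes-admissible {suc (suc _) ∷ _} (_ ∷ ps)    = adm-cons (s≤s (s≤s z≤n)) ps

fin′-admissible : ∀ {a} → Admissible a → Admissible (fin′ a)
fin′-admissible adm-nil                                   = adm-nil
fin′-admissible (adm-cons {suc zero} (s≤s ()) _)
fin′-admissible (adm-cons {suc (suc zero)} _ ps)          = dropLeadingOnes-admissible ps
fin′-admissible (adm-cons {suc (suc (suc _))} _ ps)       = adm-cons (s≤s (s≤s z≤n)) ps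

weight-dropLeadingOnes-≤ : ∀ xs → weight (dropLeadingOnes xs) ≤ weight xs
weight-dropLeadingOnes-≤ []                 = z≤n
weight-dropLeadingOnes-≤ (zero ∷ xs)        = ≤-refl
weight-dropLeadingOnes-≤ (suc zero ∷ xs)    = m≤n⇒m≤1+n (weight-dropLeadingOnes-≤ xs)
weight-dropLeadingOnes-≤ (suc (suc x) ∷ xs) = ≤-refl

weight-fin′-< : ∀ {x xs} → Admissible (x ∷ xs) → weight (fin′ (x ∷ xs)) < weight (x ∷ xs)
weight-fin′-< (adm-cons {suc zero} (s≤s ()) _)
weight-fin′-< (adm-cons {suc (suc zero)} {xs} _ _) = s≤s (m≤n⇒m≤1+n (weight-dropLeadingOnes-≤ xs))
weight-fin′-< (adm-cons {suc (suc (suc _))} _ _)   = ≤-refl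

dropLeadingOnes-init : ∀ xs → dropLeadingOnes (init xs) ≡ init (dropLeadingOnes xs)
dropLeadingOnes-init []                       = refl
dropLeadingOnes-init (zero ∷ [])              = refl
dropLeadingOnes-init (suc zero ∷ [])          = refl
dropLeadingOnes-init (suc (suc x) ∷ [])       = refl
dropLeadingOnes-init (zero ∷ y ∷ ys)          = refl
dropLeadingOnes-init (suc zero ∷ y ∷ ys)      = dropLeadingOnes-init (y ∷ ys)
dropLeadingOnes-init (suc (suc x) ∷ y ∷ ys)   = refl

fin′-init : ∀ {a} → Admissible a → fin′ (init a) ≡ init (fin′ a)
fin′-init adm-nil                                      = refl
fin′-init (adm-cons {zero} () _)
fin′-init (adm-cons {suc zero} (s≤s ()) _)
fin′-init (adm-cons {suc (suc zero)} {[]} _ _)         = refl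
fin′-init (adm-cons {suc (suc zero)} {y ∷ ys} _ _)     = dropLeadingOnes-init (y ∷ ys)
fin′-init (adm-cons {suc (suc (suc _))} {[]} _ _)      = refl
fin′-init (adm-cons {suc (suc (suc _))} {_ ∷ _} _ _)   = refl

dual-fin′ : ∀ {x xs} → Admissible (x ∷ xs) → dual (fin′ (x ∷ xs)) ≡ init (dual (x ∷ xs))
dual-fin′ {x} {xs} ad with word-fin′ ad
... | m , eq = sym (begin
  init (fromWord (dualWord (word a)))                              ≡⟨ cong (init ∘ fromWord ∘ dualWord) eq ⟩
  init (fromWord (dualWord ((false ∷ replicate m true) ++ q)))     ≡⟨ cong (init ∘ fromWord) (dualWord-++ (false ∷ replicate m true) q) ⟩
  init (fromWord (dualWord q ++ dualWord (false ∷ replicate m true))) ≡⟨ cong (λ w → init (fromWord (dualWord q ++ w))) (unfold-reverse true (map not (replicate m true))) ⟩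
  init (fromWord (dualWord q ++ dualWord (replicate m true) ∷ʳ true)) ≡⟨ cong (λ w → init (fromWord (w ++ dualWord (replicate m true) ∷ʳ true))) (sym (word-dual (fin′-admissible ad))) ⟩
  init (fromWord (word b ++ dualWord (replicate m true) ∷ʳ true))  ≡⟨ cong (λ w → init (fromWord (word b ++ w ∷ʳ true))) (dualWord-replicate m) ⟩
  init (fromWord (word b ++ replicate m false ∷ʳ true))             ≡⟨ cong init (fromWord-word-++ (admissible⇒positive (dual-admissible (fin′-admissible ad))) _) ⟩
  init (b ++ fromWord (replicate m false ∷ʳ true))                 ≡⟨ cong (init ∘ (b ++_)) (fromWord′-replicate 0 m (true ∷ [])) ⟩
  init (b ∷ʳ suc (m + 0))                                          ≡⟨ init-∷ʳ b _ ⟩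
  b                                                                ∎)
  where
  open ≡-Reasoning
  a = x ∷ xs
  q = word (fin′ a)
  b = dual (fin′ a)

fin≡fin′ : ∀ {a} → Admissible a → fin a ≡ fin′ a
fin≡fin′ adm-nil             = refl
fin≡fin′ ad@(adm-cons _ _)   = trans (cong dual (sym (dual-fin′ ad))) (dual-involutive (fin′-admissible ad))

fin-admissible : ∀ {a} → Admissible a → Admissible (fin a)
fin-admissible ad = subst Admissible (sym (fin≡fin′ ad)) (fin′-admissible ad)

init-dual : ∀ {a} → Admissible a → init (dual a) ≡ dual (fin a)
init-dual ad = sym (dual-involutive (init-admissible (dual-admissible ad)))

fin-dual : ∀ {a} → Admissible a → fin (dual a) ≡ dual (init a)
fin-dual ad = cong (dual ∘ init) (dual-involutive ad)

mid-dual : ∀ {a} → Admissible a → mid (dual a) ≡ dual (mid a)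
mid-dual {a} ad = begin
  init (fin (dual a))    ≡⟨ cong init (fin≡fin′ ād) ⟩
  init (fin′ (dual a))   ≡⟨ sym (fin′-init ād) ⟩
  fin′ (init (dual a))   ≡⟨ sym (fin≡fin′ (init-admissible ād)) ⟩
  fin (init (dual a))    ≡⟨⟩
  dual (init (fin a))    ∎
  where
  open ≡-Reasoning
  ād = dual-admissible ad

_≺_ : Composition → Composition → Set
b ≺ a = Admissible b × weight b < weight a

init-≺ : ∀ {x xs} → Admissible (x ∷ xs) → init (x ∷ xs) ≺ (x ∷ xs)
init-≺ ad = init-admissible ad , weight-init-< (admissible⇒positive ad)

fin-≺ : ∀ {x xs} → Admissible (x ∷ xs) → fin (x ∷ xs) ≺ (x ∷ xs)
fin-≺ {x} {xs} ad = fin-admissible ad , subst (λ b → weight b < weight (x ∷ xs)) (sym (fin≡fin′ ad)) (weight-fin′-< ad)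

mid-≺ : ∀ {x xs} → Admissible (x ∷ xs) → mid (x ∷ xs) ≺ (x ∷ xs)
mid-≺ {x} {xs} ad with fin-≺ ad
... | fin-adm , fin-< = init-admissible fin-adm , ≤-<-trans (weight-init-≤ (fin (x ∷ xs))) fin-<

≺-induction : (P : Composition → Set) → (∀ {a} → Admissible a → (∀ {b} → b ≺ a → P b) → P a) →
              ∀ {a} → Admissible a → P a
≺-induction P step {a} ad = go (suc (weight a)) ad ≤-refl
  where
  go : ∀ n {a} → Admissible a → weight a < n → P a
  go (suc n) ad (s≤s w≤n) = step ad (λ (ad′ , lt) → go n ad′ (<-≤-trans lt w≤n))

-- The free ℤ-module on compositions

_≟ᶜ_ : (a c : Composition) → Dec (a ≡ c)
_≟ᶜ_ = ≡-dec ℕ._≟_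

coeff₁ : ℤ × Composition → Composition → ℤ
coeff₁ (z , a) c = if does (a ≟ᶜ c) then z else 0ℤ

coeff₁-other : ∀ z {a c} → a ≢ c → coeff₁ (z , a) c ≡ 0ℤ
coeff₁-other z {a} {c} a≢c with a ≟ᶜ c
... | yes a≡c = ⊥-elim (a≢c a≡c)
... | no _    = refl

coeff₁-zero : ∀ a c → coeff₁ (0ℤ , a) c ≡ 0ℤ
coeff₁-zero a c with a ≟ᶜ c
... | yes _ = refl
... | no _  = refl

coeff₁-+ : ∀ y z a c → coeff₁ (y +ℤ z , a) c ≡ coeff₁ (y , a) c +ℤ coeff₁ (z , a) c
coeff₁-+ y z a c with a ≟ᶜ c
... | yes _ = refl
... | no _  = refl

coeff-⊕ : ∀ v w c → coeff (v ⊕ w) c ≡ coeff v c +ℤ coeff w c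
coeff-⊕ []      w c = sym (ℤ.+-identityˡ _)
coeff-⊕ (p ∷ v) w c = trans (cong (coeff₁ p c +ℤ_) (coeff-⊕ v w c)) (sym (ℤ.+-assoc (coeff₁ p c) _ _))

-- Unlike _≈_, which unfolds to a Π-type, this wrapper lets Agda infer the compared elements.
record _≋_ (v w : FreeZ) : Set where
  constructor coeffwise
  field coeff-≡ : v ≈ w

open _≋_ public

infix 4 _≋_

≋-setoid : Setoid _ _
≋-setoid = record
  { Carrier       = FreeZ
  ; _≈_           = _≋_
  ; isEquivalence = record
    { refl  = coeffwise λ _ → refl
    ; sym   = λ (coeffwise p) → coeffwise λ c → sym (p c)
    ; trans = λ (coeffwise p) (coeffwise q) → coeffwise λ c → trans (p c) (q c)
    }
  }

open Setoid ≋-setoid public using () renaming (refl to ≋-refl)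

⊕-cong : ∀ {v v′ w w′} → v ≋ v′ → w ≋ w′ → v ⊕ w ≋ v′ ⊕ w′
⊕-cong {v} {v′} {w} {w′} (coeffwise p) (coeffwise q) = coeffwise λ c → begin
  coeff (v ⊕ w) c             ≡⟨ coeff-⊕ v w c ⟩
  coeff v c +ℤ coeff w c      ≡⟨ cong₂ _+ℤ_ (p c) (q c) ⟩
  coeff v′ c +ℤ coeff w′ c    ≡⟨ coeff-⊕ v′ w′ c ⟨
  coeff (v′ ⊕ w′) c           ∎
  where open ≡-Reasoning

⊕-reverse : ∀ u v w → u ⊕ v ⊕ w ≋ w ⊕ v ⊕ u
⊕-reverse u v w = coeffwise λ c → begin
  coeff (u ⊕ v ⊕ w) c                          ≡⟨ coeff-⊕ (u ⊕ v) w c ⟩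
  coeff (u ⊕ v) c +ℤ coeff w c                 ≡⟨ cong (_+ℤ coeff w c) (coeff-⊕ u v c) ⟩
  coeff u c +ℤ coeff v c +ℤ coeff w c          ≡⟨ xy∙z≈zy∙x (coeff u c) (coeff v c) (coeff w c) ⟩
  coeff w c +ℤ coeff v c +ℤ coeff u c          ≡⟨ cong (_+ℤ coeff u c) (coeff-⊕ w v c) ⟨
  coeff (w ⊕ v) c +ℤ coeff u c                 ≡⟨ coeff-⊕ (w ⊕ v) u c ⟨
  coeff (w ⊕ v ⊕ u) c                          ∎
  where open ≡-Reasoning

mapBasis : (Composition → Composition) → FreeZ → FreeZ
mapBasis h = map (map₂ h)

without : Composition → FreeZ → FreeZ
without b = filter (λ p → ¬? (proj₂ p ≟ᶜ b))

coeff-mapBasis-without : ∀ h b v c →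
  coeff (mapBasis h v) c ≡ coeff₁ (coeff v b , h b) c +ℤ coeff (mapBasis h (without b v)) c
coeff-mapBasis-without h b []            c = sym (cong (_+ℤ 0ℤ) (coeff₁-zero (h b) c))
coeff-mapBasis-without h b ((z , a) ∷ v) c with a ≟ᶜ b
... | yes refl = begin
  coeff₁ (z , h a) c +ℤ coeff (mapBasis h v) c                 ≡⟨ cong (coeff₁ (z , h a) c +ℤ_) (coeff-mapBasis-without h a v c) ⟩
  coeff₁ (z , h a) c +ℤ (coeff₁ (coeff v a , h a) c +ℤ rest)   ≡⟨ ℤ.+-assoc (coeff₁ (z , h a) c) _ rest ⟨
  coeff₁ (z , h a) c +ℤ coeff₁ (coeff v a , h a) c +ℤ rest     ≡⟨ cong (_+ℤ rest) (coeff₁-+ z (coeff v a) (h a) c) ⟨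
  coeff₁ (z +ℤ coeff v a , h a) c +ℤ rest                      ∎
  where
  open ≡-Reasoning
  rest = coeff (mapBasis h (without a v)) c
... | no a≢b = begin
  coeff₁ (z , h a) c +ℤ coeff (mapBasis h v) c                    ≡⟨ cong (coeff₁ (z , h a) c +ℤ_) (coeff-mapBasis-without h b v c) ⟩
  coeff₁ (z , h a) c +ℤ (coeff₁ (coeff v b , h b) c +ℤ rest)      ≡⟨ x∙yz≈y∙xz (coeff₁ (z , h a) c) (coeff₁ (coeff v b , h b) c) rest ⟩
  coeff₁ (coeff v b , h b) c +ℤ (coeff₁ (z , h a) c +ℤ rest)      ≡⟨ cong (λ t → coeff₁ (t , h b) c +ℤ (coeff₁ (z , h a) c +ℤ rest)) (ℤ.+-identityˡ (coeff v b)) ⟨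
  coeff₁ (0ℤ +ℤ coeff v b , h b) c +ℤ (coeff₁ (z , h a) c +ℤ rest) ∎
  where
  open ≡-Reasoning
  rest = coeff (mapBasis h (without b v)) c

coeff-split : ∀ b v c → coeff v c ≡ coeff₁ (coeff v b , b) c +ℤ coeff (without b v) c
coeff-split b v c = begin
  coeff v c                                                           ≡⟨ cong (λ u → coeff u c) (map-id v) ⟨
  coeff (mapBasis id v) c                                             ≡⟨ coeff-mapBasis-without id b v c ⟩
  coeff₁ (coeff v b , b) c +ℤ coeff (mapBasis id (without b v)) c     ≡⟨ cong (λ u → coeff₁ (coeff v b , b) c +ℤ coeff u c) (map-id (without b v)) ⟩
  coeff₁ (coeff v b , b) c +ℤ coeff (without b v) c                   ∎
  where open ≡-Reasoning

coeff-without-self : ∀ b v → coeff (without b v) b ≡ 0ℤ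
coeff-without-self b []            = refl
coeff-without-self b ((z , a) ∷ v) with a ≟ᶜ b
... | yes refl = coeff-without-self b v
... | no a≢b   = trans (cong (_+ℤ _) (coeff₁-other z a≢b)) (trans (ℤ.+-identityˡ _) (coeff-without-self b v))

coeff-without-other : ∀ {b c} → b ≢ c → ∀ v → coeff (without b v) c ≡ coeff v c
coeff-without-other {b} {c} b≢c v =
  sym (trans (coeff-split b v c) (trans (cong (_+ℤ coeff (without b v) c) (coeff₁-other (coeff v b) b≢c)) (ℤ.+-identityˡ _)))

-- Induction on the length, removing all terms at one composition b at a time.
mapBasis-fix : ∀ h v → (∀ c → coeff v c ≢ 0ℤ → h c ≡ c) → mapBasis h v ≋ v
mapBasis-fix h v fixes = coeffwise (go (length v) v ≤-refl fixes)
  where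
  go : ∀ n v → length v ≤ n → (∀ c → coeff v c ≢ 0ℤ → h c ≡ c) → mapBasis h v ≈ v
  go _       []                 _         _     _ = refl
  go (suc n) v@((_ , b) ∷ v′)   (s≤s len) fixes c = begin
    coeff (mapBasis h v) c                                              ≡⟨ coeff-mapBasis-without h b v c ⟩
    coeff₁ (coeff v b , h b) c +ℤ coeff (mapBasis h (without b v)) c    ≡⟨ cong₂ _+ℤ_ head (go n (without b v) shorter fixes′ c) ⟩
    coeff₁ (coeff v b , b) c +ℤ coeff (without b v) c                   ≡⟨ coeff-split b v c ⟨
    coeff v c                                                           ∎
    where
    open ≡-Reasoning
    head : coeff₁ (coeff v b , h b) c ≡ coeff₁ (coeff v b , b) c
    head with coeff v b ℤ.≟ 0ℤ
    ... | yes v[b]≡0 rewrite v[b]≡0 = trans (coeff₁-zero (h b) c) (sym (coeff₁-zero b c))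
    ... | no v[b]≢0 = cong (λ a → coeff₁ (coeff v b , a) c) (fixes b v[b]≢0)
    shorter : length (without b v) ≤ n
    shorter = subst (λ u → length u ≤ n) (sym (filter-reject (λ p → ¬? (proj₂ p ≟ᶜ b)) (λ b≢b → b≢b refl)))
                    (≤-trans (length-filter (λ p → ¬? (proj₂ p ≟ᶜ b)) v′) len)
    fixes′ : ∀ c → coeff (without b v) c ≢ 0ℤ → h c ≡ c
    fixes′ c nz with b ≟ᶜ c
    ... | yes refl = ⊥-elim (nz (coeff-without-self b v))
    ... | no b≢c   = fixes c (nz ∘ trans (coeff-without-other b≢c v))

negate : FreeZ → FreeZ
negate = map (map₁ (λ z → - z))

coeff-negate : ∀ v c → coeff (negate v) c ≡ - coeff v c
coeff-negate []            c = refl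
coeff-negate ((z , a) ∷ v) c = begin
  coeff₁ (- z , a) c +ℤ coeff (negate v) c   ≡⟨ cong₂ _+ℤ_ coeff₁-negate (coeff-negate v c) ⟩
  - coeff₁ (z , a) c +ℤ - coeff v c          ≡⟨ ℤ.neg-distrib-+ (coeff₁ (z , a) c) (coeff v c) ⟨
  - (coeff₁ (z , a) c +ℤ coeff v c)          ∎
  where
  open ≡-Reasoning
  coeff₁-negate : coeff₁ (- z , a) c ≡ - coeff₁ (z , a) c
  coeff₁-negate with a ≟ᶜ c
  ... | yes _ = refl
  ... | no _  = refl

mapBasis-negate : ∀ h v → mapBasis h (negate v) ≡ negate (mapBasis h v)
mapBasis-negate h []      = refl
mapBasis-negate h (_ ∷ v) = cong (_ ∷_) (mapBasis-negate h v)

mapBasis-cong : ∀ h {v w} → v ≋ w → mapBasis h v ≋ mapBasis h w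
mapBasis-cong h {v} {w} (coeffwise v≈w) = coeffwise λ c → ℤ.i-j≡0⇒i≡j _ _ (begin
  coeff (mapBasis h v) c - coeff (mapBasis h w) c                   ≡⟨ cong (coeff (mapBasis h v) c +ℤ_) (coeff-negate (mapBasis h w) c) ⟨
  coeff (mapBasis h v) c +ℤ coeff (negate (mapBasis h w)) c          ≡⟨ coeff-⊕ (mapBasis h v) _ c ⟨
  coeff (mapBasis h v ⊕ negate (mapBasis h w)) c                     ≡⟨ cong (λ u → coeff (mapBasis h v ⊕ u) c) (mapBasis-negate h w) ⟨
  coeff (mapBasis h v ⊕ mapBasis h (negate w)) c                     ≡⟨ cong (λ u → coeff u c) (map-++ (map₂ h) v (negate w)) ⟨
  coeff (mapBasis h (v ⊕ negate w)) c                                ≡⟨ coeff-≡ (mapBasis-fix h (v ⊕ negate w) (λ c′ nz → ⊥-elim (nz (null c′)))) c ⟩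
  coeff (v ⊕ negate w) c                                             ≡⟨ null c ⟩
  0ℤ                                                                 ∎)
  where
  open ≡-Reasoning
  null : ∀ c → coeff (v ⊕ negate w) c ≡ 0ℤ
  null c = trans (coeff-⊕ v (negate w) c) (trans (cong₂ _+ℤ_ (v≈w c) (coeff-negate w c)) (ℤ.+-inverseʳ (coeff w c)))

extendTo : ℕ → Composition → Composition
extendTo k b = b ∷ʳ (k ∸ weight b)

lift : ℕ → FreeZ → FreeZ
lift k = mapBasis (extendTo k)

lift-cong : ∀ k {v w} → v ≋ w → lift k v ≋ lift k w
lift-cong k = mapBasis-cong (extendTo k)

μ-lift : ∀ k v → μ (lift k v) ≡ v
μ-lift k []            = refl
μ-lift k ((z , b) ∷ v) = cong₂ _∷_ (cong (z ,_) (init-∷ʳ b _)) (μ-lift k v)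

extendTo-init : ∀ {k c} → weight c ≡ suc k → extendTo (suc k) (init c) ≡ c
extendTo-init {k} {c} w with initLast c
... | []       = ⊥-elim (0≢1+n w)
... | ys ∷ʳ′ y = begin
  extendTo (suc k) (init (ys ∷ʳ y))     ≡⟨ cong (extendTo (suc k)) (init-∷ʳ ys y) ⟩
  ys ∷ʳ (suc k ∸ weight ys)             ≡⟨ cong (λ m → ys ∷ʳ (m ∸ weight ys)) (trans (sym w) (weight-∷ʳ ys y)) ⟩
  ys ∷ʳ (weight ys + y ∸ weight ys)     ≡⟨ cong (ys ∷ʳ_) (m+n∸m≡n (weight ys) y) ⟩
  ys ∷ʳ y                               ∎
  where open ≡-Reasoning

lift-μ : ∀ k v → InA (suc k) v → lift (suc k) (μ v) ≋ v
lift-μ k v homogeneous = subst (_≋ v) (map-∘ v)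
  (mapBasis-fix (extendTo (suc k) ∘ init) v (λ c nz → extendTo-init (proj₂ (homogeneous c nz))))

𝒜 : ℕ → Composition → Set
𝒜 k c = Admissible c × weight c ≡ k

All⇒support : ∀ {P : Composition → Set} {v} → All (P ∘ proj₂) v → ∀ c → coeff v c ≢ 0ℤ → P c
All⇒support []                       c nz = ⊥-elim (nz refl)
All⇒support {v = (z , a) ∷ _} (pa ∷ ps) c nz with a ≟ᶜ c
... | yes refl = pa
... | no _     = All⇒support ps c (nz ∘ trans (ℤ.+-identityˡ _))

extendTo-𝒜 : ∀ {k b} → 2 ≤ k → Admissible b → weight b < k → 𝒜 k (extendTo k b)
extendTo-𝒜 {k} {b} 2≤k ad lt = admissible ad lt , trans (weight-∷ʳ b (k ∸ weight b)) (m+[n∸m]≡n (<⇒≤ lt))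
  where
  admissible : ∀ {b} → Admissible b → weight b < k → Admissible (extendTo k b)
  admissible adm-nil          _  = adm-cons 2≤k []
  admissible (adm-cons p ps)  lt = adm-cons p (++⁺ ps (m<n⇒0<n∸m lt ∷ []))

-- The map δ

_∘α_ : (Composition → FreeZ) → Composition → FreeZ
f ∘α a = f (init a) ⊕ f (mid a) ⊕ f (fin a)

∘α-cong : ∀ {f g x xs} → Admissible (x ∷ xs) → (∀ {b} → b ≺ (x ∷ xs) → f b ≋ g b) → f ∘α (x ∷ xs) ≋ g ∘α (x ∷ xs)
∘α-cong ad f≋g = ⊕-cong (⊕-cong (f≋g (init-≺ ad)) (f≋g (mid-≺ ad))) (f≋g (fin-≺ ad))

∘α-dual : ∀ {f x xs} → Admissible (x ∷ xs) → (∀ {b} → b ≺ (x ∷ xs) → f b ≋ f (dual b)) →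
          f ∘α (x ∷ xs) ≋ f ∘α dual (x ∷ xs)
∘α-dual {f} {x} {xs} ad f-dual = begin
  f (init a) ⊕ f (mid a) ⊕ f (fin a)                      ≈⟨ ⊕-cong (⊕-cong (f-dual (init-≺ ad)) (f-dual (mid-≺ ad))) (f-dual (fin-≺ ad)) ⟩
  f (dual (init a)) ⊕ f (dual (mid a)) ⊕ f (dual (fin a)) ≡⟨ cong₂ _⊕_ (cong₂ _⊕_ (cong f (fin-dual ad)) (cong f (mid-dual ad))) (cong f (init-dual ad)) ⟨
  f (fin ā) ⊕ f (mid ā) ⊕ f (init ā)                      ≈⟨ ⊕-reverse (f (fin ā)) (f (mid ā)) (f (init ā)) ⟩
  f (init ā) ⊕ f (mid ā) ⊕ f (fin ā)                      ∎
  where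
  open SetoidReasoning ≋-setoid
  a = x ∷ xs
  ā = dual a

-- lift k is a right inverse of μ, so defining δ as lift k ∘ δ ∘ α in weight k forces μ ∘ δ* = δ ∘ α.
step : (Composition → FreeZ) → Composition → FreeZ
step f []        = ⟦ [] ⟧
step f a@(_ ∷ _) = lift (weight a) (f ∘α a)

step-lift : ∀ f {a} → 0 < weight a → step f a ≡ lift (weight a) (f ∘α a)
step-lift f {_ ∷ _} _ = refl

step-cong : ∀ {f g a} → Admissible a → (∀ {b} → b ≺ a → f b ≋ g b) → step f a ≋ step g a
step-cong adm-nil            _   = ≋-refl
step-cong ad@(adm-cons _ _)  f≋g = lift-cong _ (∘α-cong ad f≋g)

-- Since α lowers the weight, n iterations of step determine δ on weights < n.
approx : ℕ → Composition → FreeZ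
approx zero    _ = []
approx (suc n)   = step (approx n)

δ : Composition → FreeZ
δ a = approx (suc (weight a)) a

approx-stable : ∀ {m n a} → Admissible a → weight a < m → weight a < n → approx m a ≋ approx n a
approx-stable {suc m} {suc n} ad (s≤s w≤m) (s≤s w≤n) =
  step-cong ad (λ (ad′ , lt) → approx-stable ad′ (<-≤-trans lt w≤m) (<-≤-trans lt w≤n))

δ-unfold : ∀ {a} → Admissible a → δ a ≋ step δ a
δ-unfold ad = step-cong ad (λ (ad′ , lt) → approx-stable ad′ lt (n<1+n _))

δ-recurrence : ∀ x xs → Admissible (x ∷ xs) → μ (δ (x ∷ xs)) ≋ δ ∘α (x ∷ xs)
δ-recurrence x xs ad = subst (μ (δ (x ∷ xs)) ≋_) (μ-lift _ _) (mapBasis-cong init (δ-unfold ad))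

approx-homogeneous : ∀ n {a} → Admissible a → All (𝒜 (weight a) ∘ proj₂) (approx n a)
approx-homogeneous zero    _                   = []
approx-homogeneous (suc n) adm-nil             = (adm-nil , refl) ∷ []
approx-homogeneous (suc n) {a} ad@(adm-cons _ _) =
  map⁺ (All.map (λ (ad′ , lt) → extendTo-𝒜 (weight≥2 ad) ad′ lt)
                (++⁺ (++⁺ (lower (init-≺ ad)) (lower (mid-≺ ad))) (lower (fin-≺ ad))))
  where
  lower : ∀ {b} → b ≺ a → All (λ p → proj₂ p ≺ a) (approx n b)
  lower (ad′ , lt) = All.map (λ (ad″ , w≡) → ad″ , subst (_< weight a) (sym w≡) lt) (approx-homogeneous n ad′)

δ-homogeneous : ∀ a → Admissible a → InA (weight a) (δ a)
δ-homogeneous a ad = All⇒support (approx-homogeneous (suc (weight a)) ad)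

δ-dual : ∀ a → Admissible a → δ a ≋ δ (dual a)
δ-dual a = ≺-induction (λ a → δ a ≋ δ (dual a)) dual-step
  where
  dual-step : ∀ {a} → Admissible a → (∀ {b} → b ≺ a → δ b ≋ δ (dual b)) → δ a ≋ δ (dual a)
  dual-step adm-nil _ = ≋-refl
  dual-step {a} ad@(adm-cons _ _) ih = begin
    δ a                                     ≈⟨ δ-unfold ad ⟩
    lift (weight a) (δ ∘α a)                ≈⟨ lift-cong (weight a) (∘α-dual {δ} ad ih) ⟩
    lift (weight a) (δ ∘α dual a)           ≡⟨ cong (λ k → lift k (δ ∘α dual a)) (weight-dual ad) ⟨
    lift (weight (dual a)) (δ ∘α dual a)    ≡⟨ step-lift δ {dual a} (subst (0 <_) (sym (weight-dual ad)) (<-≤-trans (s≤s z≤n) (weight≥2 ad))) ⟨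
    step δ (dual a)                         ≈⟨ δ-unfold {dual a} (dual-admissible ad) ⟨
    δ (dual a)                              ∎
    where open SetoidReasoning ≋-setoid

isDelta-unique : ∀ d′ → IsDelta d′ → ∀ {a} → Admissible a → d′ a ≋ δ a
isDelta-unique d′ (_ , homogeneous , d′[] , recurrence) = ≺-induction (λ a → d′ a ≋ δ a) unique-step
  where
  unique-step : ∀ {a} → Admissible a → (∀ {b} → b ≺ a → d′ b ≋ δ b) → d′ a ≋ δ a
  unique-step adm-nil _ = coeffwise d′[]
  unique-step {suc x ∷ xs} ad@(adm-cons _ _) ih = begin
    d′ a                        ≈⟨ lift-μ _ (d′ a) (homogeneous a ad) ⟨
    lift (weight a) (μ (d′ a))  ≈⟨ lift-cong (weight a) (coeffwise (recurrence (suc x) xs ad)) ⟩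
    lift (weight a) (d′ ∘α a)   ≈⟨ lift-cong (weight a) (∘α-cong {d′} {δ} ad ih) ⟩
    lift (weight a) (δ ∘α a)    ≈⟨ δ-unfold ad ⟨
    δ a                         ∎
    where
    open SetoidReasoning ≋-setoid
    a = suc x ∷ xs

theorem10 : Σ (Composition → FreeZ) (λ d → IsDelta d × (∀ d′ → IsDelta d′ → ∀ a → Admissible a → d′ a ≈ d a))
theorem10 =
  δ ,
  ((λ a ad → coeff-≡ (δ-dual a ad)) , δ-homogeneous , (λ _ → refl) , (λ x xs ad → coeff-≡ (δ-recurrence x xs ad))) ,
  λ d′ isDelta′ a ad → coeff-≡ (isDelta-unique d′ isDelta′ ad)
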